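{- Let $\mathsf{M}$ be a regular matroid with a free basis. Then $\mathsf{M}$ is graphic, and is (the cycle matroid of a graph) obtained from a cycle graph with at least two edges by repeatedly adding a possibly empty set of parallel edges to one of the edges of the cycle.
   Context: A matroid is regular if it is representable over every field. A basis $B$ of a matroid $\mathsf{M}$ on $E$ is free if $\mathsf{M}$ has at least two bases and $B\cup\{e\}$ is a circuit for every $e\in E\smallsetminus B$. -}

module Defs where

open import Level using (0ℓ) renaming (suc to lsuc)
open import Data.Nat using (ℕ; zero; suc; _<_; _≤_)
open import Data.Nat.DivMod using (_mod_)
open import Data.Fin using (Fin; toℕ) renaming (zero to fzero)
open import Data.Fin.Subset using (Subset; _∈_; _∉_; _⊆_; _⊂_; _∪_; ⁅_⁆; ∣_∣) renaming (⊥ to ∅)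
open import Data.Product using (Σ; ∃; ∃-syntax; _×_; _,_)
open import Data.Sum using (_⊎_)
open import Relation.Nullary using (¬_)
open import Relation.Binary.PropositionalEquality using (_≡_; _≢_)
open import Function.Bundles using (_⇔_)
open import Function.Definitions using (Injective)
open import Algebra.Bundles using (CommutativeRing)
import Algebra.Definitions.RawMonoid as RawMonoidDefs

record Matroid (n : ℕ) : Set₁ where
  field
    Indep    : Subset n → Set
    indep-∅  : Indep ∅
    indep-⊆  : ∀ {X Y} → X ⊆ Y → Indep Y → Indep X
    augment  : ∀ {X Y} → Indep X → Indep Y → ∣ X ∣ < ∣ Y ∣ →
               ∃[ e ] (e ∈ Y × e ∉ X × Indep (X ∪ ⁅ e ⁆))

module _ {n : ℕ} (M : Matroid n) where
  open Matroid M

  IsBasis : Subset n → Set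
  IsBasis B = Indep B × (∀ X → Indep X → B ⊆ X → X ⊆ B)

  IsCircuit : Subset n → Set
  IsCircuit C = ¬ Indep C × (∀ X → X ⊂ C → Indep X)

  HasTwoBases : Set
  HasTwoBases = ∃[ B₁ ] ∃[ B₂ ] (IsBasis B₁ × IsBasis B₂ × B₁ ≢ B₂)

  IsFreeBasis : Subset n → Set
  IsFreeBasis B = HasTwoBases × IsBasis B × (∀ e → e ∉ B → IsCircuit (B ∪ ⁅ e ⁆))

record Field (c ℓ : Level.Level) : Set (lsuc (c Level.⊔ ℓ)) where
  field
    commutativeRing : CommutativeRing c ℓ
  open CommutativeRing commutativeRing public
  field
    1≉0     : ¬ (1# ≈ 0#)
    inverse : ∀ x → ¬ (x ≈ 0#) → ∃[ y ] (x * y ≈ 1#)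

module _ (F : Field 0ℓ 0ℓ) where
  open Field F
  open RawMonoidDefs +-rawMonoid using (sum)

  ColumnsIndependent : ∀ {m n} → (Fin m → Fin n → Carrier) → Subset n → Set
  ColumnsIndependent {m} {n} A X =
    (c : Fin n → Carrier) → (∀ j → j ∉ X → c j ≈ 0#) →
    (∀ i → sum (λ j → c j * A i j) ≈ 0#) → ∀ j → c j ≈ 0#

  RepresentableOver : ∀ {n} → Matroid n → Set
  RepresentableOver {n} M =
    ∃[ m ] Σ (Fin m → Fin n → Carrier) λ A →
      ∀ X → Matroid.Indep M X ⇔ ColumnsIndependent A X

Regular : ∀ {n} → Matroid n → Set₁
Regular M = (F : Field 0ℓ 0ℓ) → RepresentableOver F M

record Graph (n : ℕ) : Set where
  field
    nV   : ℕ
    ends : Fin n → Fin nV × Fin nV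

Joins : ∀ {n} (G : Graph n) → Fin n → Fin (Graph.nV G) → Fin (Graph.nV G) → Set
Joins G e a b = (Graph.ends G e ≡ (a , b)) ⊎ (Graph.ends G e ≡ (b , a))

next : ∀ {k} → Fin (suc k) → Fin (suc k)
next {k} i = suc (toℕ i) mod suc k

-- a cycle of G with all edges in X: distinct vertices w₀ … w_k and distinct
-- edges f₀ … f_k (k+1 ≥ 1 of each) with f_j joining w_j and w_{j+1 mod (k+1)}
-- (length 1 = a loop, length 2 = a pair of parallel edges)
CycleIn : ∀ {n} (G : Graph n) → Subset n → Set
CycleIn {n} G X =
  ∃[ k ] Σ (Fin (suc k) → Fin (Graph.nV G)) λ w → Σ (Fin (suc k) → Fin n) λ f →
    Injective _≡_ _≡_ w × Injective _≡_ _≡_ f ×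
    (∀ j → f j ∈ X) × (∀ j → Joins G (f j) (w j) (w (next j)))

IsForest : ∀ {n} → Graph n → Subset n → Set
IsForest G X = ¬ CycleIn G X

IsCycleMatroidOf : ∀ {n} → Matroid n → Graph n → Set
IsCycleMatroidOf M G = ∀ X → Matroid.Indep M X ⇔ IsForest G X

IsGraphic : ∀ {n} → Matroid n → Set
IsGraphic M = ∃[ G ] IsCycleMatroidOf M G

-- G is obtained from the cycle graph C_k (k ≥ 2; vertices Fin k, edge i
-- joining i and i+1 mod k) by adding a possibly empty set of edges parallel
-- to one edge of the cycle (namely edge 0).  Concretely: p e is the cycle
-- edge that e "belongs to"; every cycle edge is hit (p surjective), each
-- cycle edge other than 0 is hit exactly once, and e joins p e and p e + 1.
IsCycleWithParallelClass : ∀ {n} → Graph n → Set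
IsCycleWithParallelClass {n} G =
  ∃[ k ] Σ (Graph.nV G ≡ suc (suc k)) λ { _≡_.refl →
    Σ (Fin n → Fin (suc (suc k))) λ p →
      (∀ i → ∃[ e ] (p e ≡ i)) ×
      (∀ e e' → p e ≡ p e' → p e ≢ fzero → e ≡ e') ×
      (∀ e → Graph.ends G e ≡ (p e , next (p e))) }

{-# OPTIONS --safe #-}
module Submission where

-- Over GF(2) the indicator vector of a circuit is a null vector of any representing matrix.
-- Adding the indicators of the fundamental circuits B ∪ {e} and B ∪ {f} of two elements
-- outside the free basis B cancels B, so {e, f} is dependent: all elements outside B are
-- parallel. Hence a set is independent iff it contains neither a fundamental circuit nor two
-- elements outside B. The same holds for the forests of the graph that draws B as a path and
-- closes it with all the other elements as parallel edges: a cycle using every edge class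
-- contains a fundamental circuit, and a cycle missing some class is a closed walk in a path,
-- so it uses one class twice, necessarily the parallel one.

open import Defs
open import Level using (0ℓ)
open import Function using (_∘_; id)
open import Function.Bundles using (_⇔_; Equivalence; mk⇔)
open import Function.Definitions using (Injective)
open import Data.Empty using (⊥; ⊥-elim)
open import Data.Product using (∃-syntax; _×_; _,_; proj₁; proj₂)
import Data.Product as Product
open import Data.Sum using (_⊎_; inj₁; inj₂)
import Data.Sum as Sum
open import Data.Bool using (Bool; true; false; _xor_)
open import Data.Bool.Properties using (xor-∧-commutativeRing; ¬-not) renaming (_≟_ to _≟ᵇ_)
open import Data.Nat as Nat using (ℕ; zero; suc; s≤s; z≤n)
import Data.Nat.Properties as ℕ
open import Data.Nat.DivMod using (_%_; n%n≡0; m<n⇒m%n≡m)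
open import Data.Fin using (Fin; toℕ; fromℕ; inject₁; _≤_) renaming (zero to fzero; suc to fsuc)
open import Data.Fin.Properties
  using (toℕ-fromℕ<; toℕ-fromℕ; toℕ-inject₁; toℕ-injective; toℕ<n; suc-injective; _≟_; _≤?_;
         ≤fromℕ; ≤-antisym; ≤∧≢⇒<; any?; all?; ¬∀⟶∃¬)
open import Data.Fin.Relation.Unary.Top using (view; ‵fromℕ; ‵inj₁)
open import Data.Fin.Subset using (Subset; _∈_; _∉_; _⊆_; _∪_; ⁅_⁆; ∣_∣; inside; outside)
open import Data.Fin.Subset.Properties using (_∈?_; ⊆-antisym; x∈p∪q⁻; x∈p∪q⁺; x∈⁅x⁆; x∈⁅y⁆⇒x≡y)
open import Data.Vec.Base using ([]; _∷_; tabulate; here; there)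
open import Data.Vec.Properties using (lookup∘tabulate; []=⇒lookup; lookup⇒[]=)
open import Data.List using (allFin)
open import Data.List.Extrema.Nat using (argmax; f[xs]≤f[argmax])
open import Data.List.Membership.Propositional.Properties using (∈-allFin)
import Data.List.Relation.Unary.All as All
open import Relation.Nullary using (¬_; Dec; yes; no; contradiction)
open import Relation.Nullary.Decidable using (_×-dec_; ¬?; decidable-stable)
open import Relation.Binary.PropositionalEquality
  using (_≡_; _≢_; refl; sym; trans; cong; cong₂; subst; module ≡-Reasoning)
import Relation.Binary.Reasoning.Setoid as ≈-Reasoning
import Algebra.Properties.CommutativeMonoid.Sum as MonoidSum

toℕ-next : ∀ {m} (i : Fin (suc m)) → toℕ (next i) ≡ suc (toℕ i) % suc m
toℕ-next i = toℕ-fromℕ< _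

next-fromℕ : ∀ m → next (fromℕ m) ≡ fzero
next-fromℕ m = toℕ-injective (begin
  toℕ (next (fromℕ m))        ≡⟨ toℕ-next (fromℕ m) ⟩
  suc (toℕ (fromℕ m)) % suc m ≡⟨ cong (λ x → suc x % suc m) (toℕ-fromℕ m) ⟩
  suc m % suc m               ≡⟨ n%n≡0 (suc m) ⟩
  0                           ∎)
  where open ≡-Reasoning

next-inject₁ : ∀ {m} (i : Fin m) → next (inject₁ i) ≡ fsuc i
next-inject₁ {m} i = toℕ-injective (begin
  toℕ (next (inject₁ i))        ≡⟨ toℕ-next (inject₁ i) ⟩
  suc (toℕ (inject₁ i)) % suc m ≡⟨ cong (λ x → suc x % suc m) (toℕ-inject₁ i) ⟩
  suc (toℕ i) % suc m           ≡⟨ m<n⇒m%n≡m (s≤s (toℕ<n i)) ⟩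
  suc (toℕ i)                   ∎)
  where open ≡-Reasoning

next-injective : ∀ {m} → Injective _≡_ _≡_ (next {m})
next-injective {m} {i} {j} eq with view i | view j
... | ‵fromℕ | ‵fromℕ = refl
... | ‵fromℕ | ‵inj₁ {i = j'} _ =
  contradiction (trans (sym (next-fromℕ m)) (trans eq (next-inject₁ j'))) λ ()
... | ‵inj₁ {i = i'} _ | ‵fromℕ =
  contradiction (trans (sym (next-fromℕ m)) (trans (sym eq) (next-inject₁ i'))) λ ()
... | ‵inj₁ {i = i'} _ | ‵inj₁ {i = j'} _ =
  cong inject₁ (suc-injective (trans (sym (next-inject₁ i')) (trans eq (next-inject₁ j'))))

next-surjective : ∀ {m} (j : Fin (suc m)) → ∃[ i ] (next i ≡ j)
next-surjective {m} fzero = fromℕ m , next-fromℕ m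
next-surjective {suc m} (fsuc j) = inject₁ j , next-inject₁ j

next-irreflexive : ∀ {m} (i : Fin (suc (suc m))) → next i ≢ i
next-irreflexive {m} i eq with view i
... | ‵fromℕ = contradiction (trans (sym eq) (next-fromℕ (suc m))) λ ()
... | ‵inj₁ {i = i'} _ = ℕ.1+n≢n (begin
  suc (toℕ i')           ≡⟨ cong toℕ (trans (sym (next-inject₁ i')) eq) ⟩
  toℕ (inject₁ i')       ≡⟨ toℕ-inject₁ i' ⟩
  toℕ i'                 ∎)
  where open ≡-Reasoning

cycleGraph : ∀ m → Graph (suc m)
cycleGraph m = record { nV = suc m ; ends = λ s → s , next s }

-- Cutting the cycle at edge t unrolls it into a path; height is the position along it.
module Unrolling {k} (t : Fin (suc (suc k))) where

  height : Fin (suc (suc k)) → ℕ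
  height v with v ≤? t
  ... | yes _ = toℕ v Nat.+ suc (suc k)
  ... | no _  = toℕ v

  height-≤ : ∀ {v} → v ≤ t → height v ≡ toℕ v Nat.+ suc (suc k)
  height-≤ {v} v≤t with v ≤? t
  ... | yes _  = refl
  ... | no v≰t = contradiction v≤t v≰t

  height-≰ : ∀ {v} → ¬ v ≤ t → height v ≡ toℕ v
  height-≰ {v} v≰t with v ≤? t
  ... | yes v≤t = contradiction v≤t v≰t
  ... | no _    = refl

  height-next : ∀ {s} → s ≢ t → height (next s) ≡ suc (height s)
  height-next {s} s≢t with view s
  ... | ‵fromℕ = begin
    height (next (fromℕ (suc k))) ≡⟨ cong height (next-fromℕ (suc k)) ⟩
    height fzero                  ≡⟨ height-≤ z≤n ⟩
    suc (suc k)                   ≡⟨ cong suc (sym (toℕ-fromℕ (suc k))) ⟩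
    suc (toℕ (fromℕ (suc k)))     ≡⟨ cong suc (sym (height-≰ λ s≤t → s≢t (≤-antisym s≤t (≤fromℕ t)))) ⟩
    suc (height (fromℕ (suc k)))  ∎
    where open ≡-Reasoning
  ... | ‵inj₁ {i = i} _ rewrite next-inject₁ i with inject₁ i ≤? t
  ...   | yes i≤t = begin
    height (fsuc i)                   ≡⟨ height-≤ (subst (Nat._< toℕ t) (toℕ-inject₁ i) (≤∧≢⇒< i≤t s≢t)) ⟩
    suc (toℕ i Nat.+ suc (suc k))     ≡⟨ cong (λ x → suc (x Nat.+ suc (suc k))) (sym (toℕ-inject₁ i)) ⟩
    suc (toℕ (inject₁ i) Nat.+ suc (suc k)) ∎
    where open ≡-Reasoning
  ...   | no i≰t = begin
    height (fsuc i)          ≡⟨ height-≰ (i≰t ∘ subst (Nat._≤ toℕ t) (sym (toℕ-inject₁ i)) ∘ ℕ.<⇒≤) ⟩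
    suc (toℕ i)              ≡⟨ cong suc (sym (toℕ-inject₁ i)) ⟩
    suc (toℕ (inject₁ i))    ∎
    where open ≡-Reasoning

  descending-edge : ∀ {s a b} → s ≢ t → Joins (cycleGraph (suc k)) s a b →
                    height b Nat.≤ height a → (s , next s) ≡ (b , a)
  descending-edge s≢t (inj₂ eq) _ = eq
  descending-edge {s} {a} {b} s≢t (inj₁ eq) b≤a =
    contradiction (subst (Nat._≤ height a) climb b≤a) ℕ.1+n≰n
    where
    climb : height b ≡ suc (height a)
    climb = begin
      height b          ≡⟨ cong height (sym (cong proj₂ eq)) ⟩
      height (next s)   ≡⟨ height-next s≢t ⟩
      suc (height s)    ≡⟨ cong (suc ∘ height) (cong proj₁ eq) ⟩
      suc (height a)    ∎
      where open ≡-Reasoning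

-- Both walk edges at a highest vertex come down to it, hence they are the same edge.
closedWalk-avoiding-edge-repeats :
  ∀ {k l} {t : Fin (suc (suc k))} (w s : Fin (suc l) → Fin (suc (suc k))) →
  (∀ j → s j ≢ t) → (∀ j → Joins (cycleGraph (suc k)) (s j) (w j) (w (next j))) →
  ∃[ i ] ∃[ j ] (i ≢ j × s i ≡ s j)
closedWalk-avoiding-edge-repeats {t = t} w s avoids joins =
  i , top , i≢top , next-injective (trans (cong proj₂ enter) (sym (cong proj₂ leave)))
  where
  open Unrolling t
  top : Fin _
  top = argmax (height ∘ w) fzero (allFin _)
  highest : ∀ j → height (w j) Nat.≤ height (w top)
  highest j = All.lookup (f[xs]≤f[argmax] {f = height ∘ w} fzero (allFin _)) (∈-allFin j)
  i : Fin _
  i = proj₁ (next-surjective top)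
  next-i : next i ≡ top
  next-i = proj₂ (next-surjective top)
  leave : (s top , next (s top)) ≡ (w (next top) , w top)
  leave = descending-edge (avoids top) (joins top) (highest (next top))
  enter : (s i , next (s i)) ≡ (w i , w top)
  enter = descending-edge (avoids i)
            (Sum.swap (subst (Joins (cycleGraph (suc _)) (s i) (w i) ∘ w) next-i (joins i)))
            (highest i)
  i≢top : i ≢ top
  i≢top i≡top = next-irreflexive (s top) (begin
    next (s top)   ≡⟨ cong proj₂ leave ⟩
    w top          ≡⟨ cong w (sym (trans (cong next (sym i≡top)) next-i)) ⟩
    w (next top)   ≡⟨ sym (cong proj₁ leave) ⟩
    s top          ∎)
    where open ≡-Reasoning

record Enumeration {n} (p : Subset n) (r : ℕ) : Set where
  field
    element           : Fin r → Fin n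
    element-injective : Injective _≡_ _≡_ element
    element∈          : ∀ i → element i ∈ p
    index             : ∀ {x} → x ∈ p → ∃[ i ] (element i ≡ x)

enumerate : ∀ {n} (p : Subset n) → Enumeration p ∣ p ∣
enumerate [] = record
  { element = λ () ; element-injective = λ {} ; element∈ = λ () ; index = λ () }
enumerate (outside ∷ p) = record
  { element           = fsuc ∘ element
  ; element-injective = element-injective ∘ suc-injective
  ; element∈          = there ∘ element∈
  ; index             = λ { (there x∈p) → Product.map₂ (cong fsuc) (index x∈p) }
  }
  where open Enumeration (enumerate p)
enumerate (inside ∷ p) = record
  { element           = element′
  ; element-injective = injective
  ; element∈          = λ { fzero → here ; (fsuc i) → there (element∈ i) }
  ; index             = λ { here → fzero , refl
                          ; (there x∈p) → Product.map fsuc (cong fsuc) (index x∈p) }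
  }
  where
  open Enumeration (enumerate p)
  element′ : Fin (suc ∣ p ∣) → Fin _
  element′ fzero    = fzero
  element′ (fsuc i) = fsuc (element i)
  injective : Injective _≡_ _≡_ element′
  injective {fzero}  {fzero}  _  = refl
  injective {fsuc i} {fsuc j} eq = cong fsuc (element-injective (suc-injective eq))

⊆-or-∃∉ : ∀ {n} (p q : Subset n) → p ⊆ q ⊎ ∃[ x ] (x ∈ p × x ∉ q)
⊆-or-∃∉ p q with any? (λ x → x ∈? p ×-dec ¬? (x ∈? q))
... | yes (x , x∈p , x∉q) = inj₂ (x , x∈p , x∉q)
... | no none = inj₁ λ {x} x∈p → decidable-stable (x ∈? q) (λ x∉q → none (x , x∈p , x∉q))

∪⁅⁆-⊆ : ∀ {n} {p q : Subset n} {x} → p ⊆ q → x ∈ q → p ∪ ⁅ x ⁆ ⊆ q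
∪⁅⁆-⊆ {p = p} {q} {x} p⊆q x∈q {y} y∈ with x∈p∪q⁻ p ⁅ x ⁆ y∈
... | inj₁ y∈p   = p⊆q y∈p
... | inj₂ y∈⁅x⁆ = subst (_∈ q) (sym (x∈⁅y⁆⇒x≡y x y∈⁅x⁆)) x∈q

∉-∪⁅⁆ : ∀ {n} {p : Subset n} {x y} → x ∉ p → x ≢ y → x ∉ p ∪ ⁅ y ⁆
∉-∪⁅⁆ {p = p} {x} {y} x∉p x≢y x∈ with x∈p∪q⁻ p ⁅ y ⁆ x∈
... | inj₁ x∈p   = x∉p x∈p
... | inj₂ x∈⁅y⁆ = x≢y (x∈⁅y⁆⇒x≡y y x∈⁅y⁆)

∈-tabulate⁺ : ∀ {n} {c : Fin n → Bool} {x} → c x ≡ true → x ∈ tabulate c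
∈-tabulate⁺ {c = c} {x} cx≡true = lookup⇒[]= x (tabulate c) (trans (lookup∘tabulate c x) cx≡true)

∈-tabulate⁻ : ∀ {n} {c : Fin n → Bool} {x} → x ∈ tabulate c → c x ≡ true
∈-tabulate⁻ {c = c} {x} x∈ = trans (sym (lookup∘tabulate c x)) ([]=⇒lookup x∈)

module _ (F : Field 0ℓ 0ℓ) where
  open Field F
  open MonoidSum +-commutativeMonoid using (sum; ∑-distrib-+; sum-cong-≋)
  open ≈-Reasoning setoid

  NullVector : ∀ {m n} → (Fin m → Fin n → Carrier) → (Fin n → Carrier) → Set
  NullVector A c = ∀ i → sum (λ j → c j * A i j) ≈ 0#

  nullVector-+ : ∀ {m n} {A : Fin m → Fin n → Carrier} {c d} →
                 NullVector A c → NullVector A d → NullVector A (λ j → c j + d j)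
  nullVector-+ {A = A} {c} {d} Ac≈0 Ad≈0 i = begin
    sum (λ j → (c j + d j) * A i j)                        ≈⟨ sum-cong-≋ (λ j → distribʳ (A i j) (c j) (d j)) ⟩
    sum (λ j → c j * A i j + d j * A i j)                  ≈⟨ ∑-distrib-+ (λ j → c j * A i j) (λ j → d j * A i j) ⟩
    sum (λ j → c j * A i j) + sum (λ j → d j * A i j)      ≈⟨ +-cong (Ac≈0 i) (Ad≈0 i) ⟩
    0# + 0#                                                ≈⟨ +-identityˡ 0# ⟩
    0#                                                     ∎

GF2 : Field 0ℓ 0ℓ
GF2 = record
  { commutativeRing = xor-∧-commutativeRing
  ; 1≉0             = λ ()
  ; inverse         = λ { true _ → true , refl ; false 0≢0 → contradiction refl 0≢0 }
  }

module BinaryRepresentation {n} (M : Matroid n) {m} (A : Fin m → Fin n → Bool)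
       (represents : ∀ X → Matroid.Indep M X ⇔ ColumnsIndependent GF2 A X) where
  open Matroid M

  SupportedIn : Subset n → (Fin n → Bool) → Set
  SupportedIn X c = ∀ j → j ∉ X → c j ≡ false

  Indicates : Subset n → (Fin n → Bool) → Set
  Indicates X c = SupportedIn X c × (∀ {x} → x ∈ X → c x ≡ true)

  null-vector-vanishes : ∀ {X c} → Indep X → SupportedIn X c → NullVector GF2 A c → ∀ j → c j ≡ false
  null-vector-vanishes {X} X-indep = Equivalence.to (represents X) X-indep _

  null-vector-fills-circuit : ∀ {C c j} → IsCircuit M C → SupportedIn C c → NullVector GF2 A c →
                              c j ≡ true → Indicates C c
  null-vector-fills-circuit {C} {c} {j} (_ , proper⇒indep) c-supp c-null cj≡true = c-supp , fills
    where
    support⊆C : tabulate c ⊆ C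
    support⊆C {y} y∈ = decidable-stable (y ∈? C) λ y∉C →
      contradiction (trans (sym (∈-tabulate⁻ y∈)) (c-supp y y∉C)) λ ()
    fills : ∀ {x} → x ∈ C → c x ≡ true
    fills {x} x∈C = decidable-stable (c x ≟ᵇ true) λ cx≢true →
      let support-indep = proper⇒indep (tabulate c) (support⊆C , x , x∈C , cx≢true ∘ ∈-tabulate⁻)
          cj≡false      = null-vector-vanishes support-indep (λ y y∉ → ¬-not (y∉ ∘ ∈-tabulate⁺)) c-null j
      in contradiction (trans (sym cj≡true) cj≡false) λ ()

  circuit-indicator-null : ∀ {C} → IsCircuit M C → ¬ (∀ c → Indicates C c → ¬ NullVector GF2 A c)
  circuit-indicator-null {C} C-circuit none = proj₁ C-circuit (Equivalence.from (represents C)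
    λ c c-supp c-null j → ¬-not λ cj≡true →
      none c (null-vector-fills-circuit C-circuit c-supp c-null cj≡true) c-null)

-- For a free basis B of a binary matroid the circuits are the sets B ∪ ⁅ e ⁆ with e ∉ B and
-- the pairs of elements outside B.
CircuitFree : ∀ {n} → Subset n → Subset n → Set
CircuitFree B X = (∀ {e f} → e ∈ X → f ∈ X → e ∉ B → f ∉ B → e ≡ f)
                × (∀ {e} → e ∈ X → e ∉ B → ∃[ b ] (b ∈ B × b ∉ X))

module BinaryFreeBasis {n} (M : Matroid n) {m} (A : Fin m → Fin n → Bool)
       (represents : ∀ X → Matroid.Indep M X ⇔ ColumnsIndependent GF2 A X)
       {B : Subset n} (basis : IsBasis M B) (fundamental : ∀ e → e ∉ B → IsCircuit M (B ∪ ⁅ e ⁆)) where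
  open Matroid M
  open BinaryRepresentation M A represents

  outside-pair-dependent : ∀ {X e f} → e ∉ B → f ∉ B → e ≢ f → e ∈ X → f ∈ X → ¬ Indep X
  outside-pair-dependent {X} {e} {f} e∉B f∉B e≢f e∈X f∈X X-indep =
    circuit-indicator-null (fundamental e e∉B) λ c c-indicates c-null →
    circuit-indicator-null (fundamental f f∉B) λ d d-indicates d-null →
    contradiction (trans (sym (sum-at-e c-indicates d-indicates))
                         (null-vector-vanishes X-indep (sum-supported c-indicates d-indicates)
                                               (nullVector-+ GF2 {A = A} {c} {d} c-null d-null) e))
                  λ ()
    where
    sum-at-e : ∀ {c d} → Indicates (B ∪ ⁅ e ⁆) c → Indicates (B ∪ ⁅ f ⁆) d → c e xor d e ≡ true
    sum-at-e (_ , c-full) (d-supp , _) =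
      cong₂ _xor_ (c-full (x∈p∪q⁺ (inj₂ (x∈⁅x⁆ e)))) (d-supp e (∉-∪⁅⁆ e∉B e≢f))
    sum-supported : ∀ {c d} → Indicates (B ∪ ⁅ e ⁆) c → Indicates (B ∪ ⁅ f ⁆) d →
                    SupportedIn X (λ j → c j xor d j)
    sum-supported (c-supp , c-full) (d-supp , d-full) j j∉X with j ∈? B
    ... | yes j∈B = cong₂ _xor_ (c-full (x∈p∪q⁺ (inj₁ j∈B))) (d-full (x∈p∪q⁺ (inj₁ j∈B)))
    ... | no j∉B  = cong₂ _xor_ (c-supp j (∉-∪⁅⁆ j∉B λ { refl → j∉X e∈X }))
                                (d-supp j (∉-∪⁅⁆ j∉B λ { refl → j∉X f∈X }))

  independent⇒circuitFree : ∀ {X} → Indep X → CircuitFree B X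
  independent⇒circuitFree {X} X-indep = parallel , misses-basis
    where
    parallel : ∀ {e f} → e ∈ X → f ∈ X → e ∉ B → f ∉ B → e ≡ f
    parallel {e} {f} e∈X f∈X e∉B f∉B with e ≟ f
    ... | yes e≡f = e≡f
    ... | no e≢f  = contradiction X-indep (outside-pair-dependent e∉B f∉B e≢f e∈X f∈X)
    misses-basis : ∀ {e} → e ∈ X → e ∉ B → ∃[ b ] (b ∈ B × b ∉ X)
    misses-basis {e} e∈X e∉B with ⊆-or-∃∉ B X
    ... | inj₂ witness = witness
    ... | inj₁ B⊆X     = contradiction (indep-⊆ (∪⁅⁆-⊆ {p = B} {X} {e} B⊆X e∈X) X-indep)
                                       (proj₁ (fundamental e e∉B))

  circuitFree⇒independent : ∀ {X} → CircuitFree B X → Indep X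
  circuitFree⇒independent {X} (parallel , misses-basis) with ⊆-or-∃∉ X B
  ... | inj₁ X⊆B = indep-⊆ X⊆B (proj₁ basis)
  ... | inj₂ (e , e∈X , e∉B) with misses-basis e∈X e∉B
  ...   | b , b∈B , b∉X = proj₂ (fundamental e e∉B) X (X⊆B∪e , b , x∈p∪q⁺ (inj₁ b∈B) , b∉X)
    where
    X⊆B∪e : X ⊆ B ∪ ⁅ e ⁆
    X⊆B∪e {x} x∈X with x ∈? B
    ... | yes x∈B = x∈p∪q⁺ (inj₁ x∈B)
    ... | no x∉B  = x∈p∪q⁺ (inj₂ (subst (_∈ ⁅ e ⁆) (sym (parallel x∈X e∈X x∉B e∉B)) (x∈⁅x⁆ e)))

module ParallelCycle {n k} {B : Subset n} (E : Enumeration B (suc k)) where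
  open Enumeration E

  -- slot x is the cycle edge along which x is drawn: element i of B becomes edge i + 1,
  -- and every element outside B is parallel to edge 0.
  slot : Fin n → Fin (suc (suc k))
  slot x with x ∈? B
  ... | yes x∈B = fsuc (proj₁ (index x∈B))
  ... | no _    = fzero

  slot-outside : ∀ {x} → x ∉ B → slot x ≡ fzero
  slot-outside {x} x∉B with x ∈? B
  ... | yes x∈B = contradiction x∈B x∉B
  ... | no _    = refl

  slot-inside : ∀ {x} → x ∈ B → ∃[ i ] (element i ≡ x × slot x ≡ fsuc i)
  slot-inside {x} x∈B with x ∈? B
  ... | yes x∈B′ = proj₁ (index x∈B′) , proj₂ (index x∈B′) , refl
  ... | no x∉B   = contradiction x∈B x∉B

  slot≡0⇒∉ : ∀ {x} → slot x ≡ fzero → x ∉ B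
  slot≡0⇒∉ slot≡0 x∈B with slot-inside x∈B
  ... | _ , _ , slot≡suc = contradiction (trans (sym slot≡suc) slot≡0) λ ()

  slot-element : ∀ i → slot (element i) ≡ fsuc i
  slot-element i with slot-inside (element∈ i)
  ... | j , element-j≡ , slot≡suc = trans slot≡suc (cong fsuc (element-injective element-j≡))

  slot≢0⇒∈ : ∀ {x} → slot x ≢ fzero → x ∈ B
  slot≢0⇒∈ {x} slot-x≢0 = decidable-stable (x ∈? B) (slot-x≢0 ∘ slot-outside)

  slot-injective : ∀ {x y} → slot x ≡ slot y → slot x ≢ fzero → x ≡ y
  slot-injective {x} {y} slot-x≡slot-y slot-x≢0
    with slot-inside (slot≢0⇒∈ slot-x≢0) | slot-inside (slot≢0⇒∈ (slot-x≢0 ∘ trans slot-x≡slot-y))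
  ... | i , element-i≡x , slot-x≡ | j , element-j≡y , slot-y≡ = begin
    x          ≡⟨ sym element-i≡x ⟩
    element i  ≡⟨ cong element (suc-injective (trans (sym slot-x≡) (trans slot-x≡slot-y slot-y≡))) ⟩
    element j  ≡⟨ element-j≡y ⟩
    y          ∎
    where open ≡-Reasoning

  graph : Graph n
  graph = record { nV = suc (suc k) ; ends = Graph.ends (cycleGraph (suc k)) ∘ slot }

  graph-isCycleWithParallelClass : ∀ {e} → e ∉ B → IsCycleWithParallelClass graph
  graph-isCycleWithParallelClass {e} e∉B =
    k , refl , slot , slot-onto , (λ _ _ → slot-injective) , λ _ → refl
    where
    slot-onto : ∀ i → ∃[ x ] (slot x ≡ i)
    slot-onto fzero    = e , slot-outside e∉B
    slot-onto (fsuc i) = element i , slot-element i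

  digon : ∀ {X e f} → e ∉ B → f ∉ B → e ≢ f → e ∈ X → f ∈ X → CycleIn graph X
  digon {X} {e} {f} e∉B f∉B e≢f e∈X f∈X =
    1 , vertex , edge , vertex-injective , edge-injective , edge∈X , joins
    where
    vertex : Fin 2 → Fin (suc (suc k))
    vertex fzero        = fzero
    vertex (fsuc fzero) = fsuc fzero
    vertex-injective : Injective _≡_ _≡_ vertex
    vertex-injective {fzero}      {fzero}      _  = refl
    vertex-injective {fzero}      {fsuc fzero} ()
    vertex-injective {fsuc fzero} {fzero}      ()
    vertex-injective {fsuc fzero} {fsuc fzero} _  = refl
    edge : Fin 2 → Fin n
    edge fzero        = e
    edge (fsuc fzero) = f
    edge-injective : Injective _≡_ _≡_ edge
    edge-injective {fzero}      {fzero}      _   = refl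
    edge-injective {fzero}      {fsuc fzero} e≡f = contradiction e≡f e≢f
    edge-injective {fsuc fzero} {fzero}      f≡e = contradiction (sym f≡e) e≢f
    edge-injective {fsuc fzero} {fsuc fzero} _   = refl
    edge∈X : ∀ j → edge j ∈ X
    edge∈X fzero        = e∈X
    edge∈X (fsuc fzero) = f∈X
    joins : ∀ j → Joins graph (edge j) (vertex j) (vertex (next j))
    joins fzero        = inj₁ (cong (λ v → v , next v) (slot-outside e∉B))
    joins (fsuc fzero) = inj₂ (cong (λ v → v , next v) (slot-outside f∉B))

  hamiltonianCycle : ∀ {X e} → e ∉ B → e ∈ X → B ⊆ X → CycleIn graph X
  hamiltonianCycle {X} {e} e∉B e∈X B⊆X =
    suc k , id , edge , id , edge-injective , edge∈X , λ j → inj₁ (cong (λ v → v , next v) (slot-edge j))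
    where
    edge : Fin (suc (suc k)) → Fin n
    edge fzero    = e
    edge (fsuc i) = element i
    slot-edge : ∀ j → slot (edge j) ≡ j
    slot-edge fzero    = slot-outside e∉B
    slot-edge (fsuc i) = slot-element i
    edge-injective : Injective _≡_ _≡_ edge
    edge-injective {i} {j} edge-i≡edge-j =
      trans (sym (slot-edge i)) (trans (cong slot edge-i≡edge-j) (slot-edge j))
    edge∈X : ∀ j → edge j ∈ X
    edge∈X fzero    = e∈X
    edge∈X (fsuc i) = B⊆X (element∈ i)

  forest⇒circuitFree : ∀ {X} → IsForest graph X → CircuitFree B X
  forest⇒circuitFree {X} acyclic = parallel , misses-basis
    where
    parallel : ∀ {e f} → e ∈ X → f ∈ X → e ∉ B → f ∉ B → e ≡ f
    parallel {e} {f} e∈X f∈X e∉B f∉B with e ≟ f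
    ... | yes e≡f = e≡f
    ... | no e≢f  = contradiction (digon e∉B f∉B e≢f e∈X f∈X) acyclic
    misses-basis : ∀ {e} → e ∈ X → e ∉ B → ∃[ b ] (b ∈ B × b ∉ X)
    misses-basis e∈X e∉B with ⊆-or-∃∉ B X
    ... | inj₂ witness = witness
    ... | inj₁ B⊆X     = contradiction (hamiltonianCycle e∉B e∈X B⊆X) acyclic

  covered-basis : ∀ {l} {c : Fin l → Fin n} → (∀ t → ∃[ j ] (slot (c j) ≡ t)) →
                  ∀ {b} → b ∈ B → ∃[ j ] (c j ≡ b)
  covered-basis covered {b} b∈B = Product.map₂ (λ same-slot → slot-injective same-slot (nonzero same-slot))
                                               (covered (slot b))
    where
    nonzero : ∀ {x} → slot x ≡ slot b → slot x ≢ fzero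
    nonzero same-slot slot≡0 = slot≡0⇒∉ (trans (sym same-slot) slot≡0) b∈B

  circuitFree⇒forest : ∀ {X} → CircuitFree B X → IsForest graph X
  circuitFree⇒forest {X} (parallel , misses-basis) (l , w , c , _ , c-injective , c∈X , joins) =
    coverage (all? λ t → any? λ j → slot (c j) ≟ t)
    where
    repeated-slot : ∀ {i j} → i ≢ j → slot (c i) ≡ slot (c j) → Dec (slot (c i) ≡ fzero) → ⊥
    repeated-slot {i} {j} i≢j same-slot (yes slot≡0) = i≢j (c-injective
      (parallel (c∈X i) (c∈X j) (slot≡0⇒∉ slot≡0) (slot≡0⇒∉ (trans (sym same-slot) slot≡0))))
    repeated-slot i≢j same-slot (no slot≢0) = i≢j (c-injective (slot-injective same-slot slot≢0))

    coverage : Dec (∀ t → ∃[ j ] (slot (c j) ≡ t)) → ⊥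
    coverage (yes covered) =
      let j₀ , slot-j₀≡0 = covered fzero
          b , b∈B , b∉X  = misses-basis (c∈X j₀) (slot≡0⇒∉ slot-j₀≡0)
          j , c-j≡b      = covered-basis covered b∈B
      in b∉X (subst (_∈ X) c-j≡b (c∈X j))
    coverage (no uncovered) =
      let t , t-unused   = ¬∀⟶∃¬ _ _ (λ t → any? λ j → slot (c j) ≟ t) uncovered
          i , j , i≢j , same-slot =
            closedWalk-avoiding-edge-repeats w (slot ∘ c) (λ j slot≡t → t-unused (j , slot≡t)) joins
      in repeated-slot i≢j same-slot (slot (c i) ≟ fzero)

freeBasis-proper : ∀ {n} {M : Matroid n} {B} → IsFreeBasis M B → (∃[ b ] b ∈ B) × (∃[ e ] e ∉ B)
freeBasis-proper {n} {M} {B} ((B₁ , B₂ , basis₁ , basis₂ , B₁≢B₂) , basis , fundamental) =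
  nonempty , proper
  where
  open Matroid M
  unique-basis : (∀ {B′} → IsBasis M B′ → B′ ≡ B) → ⊥
  unique-basis unique = B₁≢B₂ (trans (unique basis₁) (sym (unique basis₂)))
  nonempty : ∃[ b ] b ∈ B
  nonempty with any? (_∈? B)
  ... | yes b∈B = b∈B
  ... | no empty = ⊥-elim (unique-basis λ basis′ →
    ⊆-antisym (⊆B (proj₁ basis′)) (⊥-elim ∘ empty ∘ (_ ,_)))
    where
    ⊆B : ∀ {X} → Indep X → X ⊆ B
    ⊆B {X} X-indep {x} x∈X = contradiction
      (indep-⊆ (∪⁅⁆-⊆ {p = B} {X} {x} (⊥-elim ∘ empty ∘ (_ ,_)) x∈X) X-indep)
      (proj₁ (fundamental x (empty ∘ (x ,_))))
  proper : ∃[ e ] e ∉ B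
  proper with any? (λ x → ¬? (x ∈? B))
  ... | yes e∉B = e∉B
  ... | no full = ⊥-elim (unique-basis λ basis′ →
    ⊆-antisym (λ _ → everywhere) (proj₂ basis′ B (proj₁ basis) (λ _ → everywhere)))
    where
    everywhere : ∀ {x} → x ∈ B
    everywhere {x} = decidable-stable (x ∈? B) λ x∉B → full (x , x∉B)

proposition6p1 : ∀ {n} (M : Matroid n) → Regular M → (∃[ B ] IsFreeBasis M B) →
    IsGraphic M × (∃[ G ] (IsCycleWithParallelClass G × IsCycleMatroidOf M G))
proposition6p1 M regular (B , free@(_ , basis , fundamental))
  with freeBasis-proper {M = M} free | regular GF2 | ∣ B ∣ | enumerate B
... | (b , b∈B) , _ | _ | zero | E = contradiction (proj₁ (Enumeration.index E b∈B)) λ ()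
... | _ , (e , e∉B) | m , A , represents | suc k | E =
  (graph , cycleMatroid) , graph , graph-isCycleWithParallelClass e∉B , cycleMatroid
  where
  open ParallelCycle E
  open BinaryFreeBasis M A represents basis fundamental
  cycleMatroid : IsCycleMatroidOf M graph
  cycleMatroid X = mk⇔ (circuitFree⇒forest ∘ independent⇒circuitFree)
                       (circuitFree⇒independent ∘ forest⇒circuitFree)
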